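{- Let $\mathfrak G=(X,1,\curlywedge,s,A)$ be a general selection L-frame. Then: (1) $\mathfrak G$ validates $\top\trianglelefteq p\Rightarrow p$ iff $s(x,a)\subseteq a$ for all $x\in X$, $a\in A$; (2) $\mathfrak G$ validates $p\trianglelefteq\top\Rightarrow p$ iff for all $x\in X$, $a\in A$, $x\in a$ implies $s(x,X)\subseteq a$; (3) $\mathfrak G$ validates $p\trianglelefteq q\Rightarrow p$ iff for all $x\in X$, $a,b\in A$, $x\in a$ implies $s(x,b)\subseteq a$; (4) $\mathfrak G$ validates $p\wedge q\trianglelefteq p\Rightarrow q$ iff for all $x\in X$, $a,b\in A$, $x\in a\cap b$ implies $s(x,a)\subseteq b$. Moreover, if $\mathfrak G$ is full or descriptive, then the condition in (3) is equivalent to: $s(x,a)\subseteq{\uparrow}x$ for all $x\in X$, $a\in A$; and the condition in (4) is equivalent to: for all $x\in X$, $a\in A$, $x\in a$ implies $s(x,a)\subseteq{\uparrow}x$.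
   Context: Meet-semilattice $(X,1,\curlywedge)$, $x\preccurlyeq y$ iff $x\curlywedge y=x$, ${\uparrow}x=\{y:x\preccurlyeq y\}$; filters are upward closed subsets closed under finite meets; $\mathcal F(X)$ is the set of filters; $p\sqcup q:={\uparrow}\{x\curlywedge y:x\in p,y\in q\}$. A general selection L-frame is $(X,1,\curlywedge,s,A)$ where $A\subseteq\mathcal F(X)$ contains $X$ and $\{1\}$ and is closed under $\cap$, $\sqcup$ and $a\Rightarrow b:=\{x:s(x,a)\subseteq b\}$, and $s:X\times A\to\mathcal F(X)$ satisfies for $a\in A$: $s(1,a)=\{1\}$; $x\preccurlyeq y$ implies $s(y,a)\subseteq s(x,a)$; if $z\in s(x\curlywedge y,a)$ there are $u\in s(x,a)$, $v\in s(y,a)$ with $u\curlywedge v\preccurlyeq z$. Formulas $\phi::=p\mid\top\mid\bot\mid\phi\wedge\phi\mid\phi\vee\phi\mid\phi\Rightarrow\phi$ are interpreted under an admissible valuation $V$ (letters to $A$): $x\Vdash p$ iff $x\in V(p)$; $\top$ always; $x\Vdash\bot$ iff $x=1$; $\wedge$ pointwise; $x\Vdash\phi\vee\psi$ iff some $y\Vdash\phi$, $z\Vdash\psi$ satisfy $y\curlywedge z\preccurlyeq x$; $x\Vdash\phi\Rightarrow\psi$ iff $s(x,[\![\phi]\!])\subseteq[\![\psi]\!]$. $\mathfrak G$ validates $\phi\trianglelefteq\psi$ if $[\![\phi]\!]\subseteq[\![\psi]\!]$ under every admissible valuation. $\mathfrak G$ is full if $A=\mathcal F(X)$. It is descriptive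 if it arises from a selection L-space, i.e.\ there is a topology $\tau$ on $X$ making $(X,\tau)$ compact, with $A$ the set of clopen filters, clopen filters closed under $\sqcup$, HMS separation (if $x\not\preccurlyeq y$ some clopen filter contains $x$ but not $y$), $s(x,a)$ a closed filter for each $x$ and clopen filter $a$, and $a\Rightarrow b$ clopen for clopen filters $a,b$. -}

module Defs where

open import Level using (0ℓ)
open import Data.Nat using (ℕ)
open import Data.Unit using (⊤)
open import Data.Empty using ()
open import Data.List using (List)
open import Data.List.Membership.Propositional using (_∈_)
open import Data.Product using (Σ; ∃; ∃-syntax; _×_; _,_; proj₁; proj₂)
open import Function.Bundles using (_⇔_)
open import Relation.Nullary using (¬_)
open import Relation.Binary.PropositionalEquality using (_≡_)
import Algebra.Lattice.Structures as LS

Subset : Set → Set₁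
Subset X = X → Set

_⊆_ : {X : Set} → Subset X → Subset X → Set
a ⊆ b = ∀ {x} → a x → b x

_≐_ : {X : Set} → Subset X → Subset X → Set
a ≐ b = ∀ x → (a x ⇔ b x)

_∩_ : {X : Set} → Subset X → Subset X → Subset X
(a ∩ b) x = a x × b x

module SemilatticeNotions {X : Set} (𝟏 : X) (_⋏_ : X → X → X) where

  _≼_ : X → X → Set
  x ≼ y = x ⋏ y ≡ x

  ↑ : X → Subset X
  ↑ x y = x ≼ y

  record IsFilter (F : Subset X) : Set where
    field
      upward : ∀ {x y} → F x → x ≼ y → F y
      has-𝟏  : F 𝟏
      meet   : ∀ {x y} → F x → F y → F (x ⋏ y)

  ｛𝟏｝ : Subset X
  ｛𝟏｝ x = x ≡ 𝟏

  _⊔_ : Subset X → Subset X → Subset X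
  (p ⊔ q) z = ∃[ x ] ∃[ y ] (p x × q y × ((x ⋏ y) ≼ z))

-- Elements of A are represented as pairs
-- (a , proof that a ∈ A); s is required to respect extensional equality
-- of its argument (it is a function on *sets*), and A is closed under
-- extensional equality of subsets.

record GSLFrame (X : Set) : Set₁ where
  field
    𝟏   : X
    _⋏_ : X → X → X
    isBoundedSemilattice : LS.IsBoundedSemilattice (_≡_ {A = X}) _⋏_ 𝟏

  open SemilatticeNotions 𝟏 _⋏_ public

  field
    A      : Subset X → Set
    A-ext  : ∀ {a b} → a ≐ b → A a → A b
    A⊆𝓕    : ∀ {a} → A a → IsFilter a

  A-elt : Set₁
  A-elt = Σ (Subset X) A

  field
    s        : X → A-elt → Subset X
    s-ext    : ∀ x (a b : A-elt) → proj₁ a ≐ proj₁ b → s x a ≐ s x b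
    s-filter : ∀ x a → IsFilter (s x a)
    s-𝟏      : ∀ a → s 𝟏 a ≐ ｛𝟏｝
    s-anti   : ∀ {x y} a → x ≼ y → s y a ⊆ s x a
    s-meet   : ∀ {x y z} a → s (x ⋏ y) a z →
               ∃[ u ] ∃[ v ] (s x a u × s y a v × ((u ⋏ v) ≼ z))

  _⇒ₛ_ : A-elt → Subset X → Subset X
  (a ⇒ₛ b) x = s x a ⊆ b

  field
    A-X : A (λ _ → ⊤)
    A-𝟏 : A ｛𝟏｝
    A-∩ : ∀ {a b} → A a → A b → A (a ∩ b)
    A-⊔ : ∀ {a b} → A a → A b → A (a ⊔ b)
    A-⇒ : ∀ {a b} (pa : A a) → A b → A ((a , pa) ⇒ₛ b)

  Xᴬ : A-elt
  Xᴬ = (λ _ → ⊤) , A-X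

data Formula : Set where
  var        : ℕ → Formula
  ⊤ᶠ ⊥ᶠ      : Formula
  _∧ᶠ_ _∨ᶠ_ _⇒ᶠ_ : Formula → Formula → Formula

module Semantics {X : Set} (G : GSLFrame X) where
  open GSLFrame G

  Valuation : Set₁
  Valuation = ℕ → A-elt

  ⟦_⟧ᴬ : Formula → Valuation → A-elt
  ⟦ var n ⟧ᴬ V = V n
  ⟦ ⊤ᶠ ⟧ᴬ V = Xᴬ
  ⟦ ⊥ᶠ ⟧ᴬ V = ｛𝟏｝ , A-𝟏
  ⟦ φ ∧ᶠ ψ ⟧ᴬ V = (proj₁ (⟦ φ ⟧ᴬ V) ∩ proj₁ (⟦ ψ ⟧ᴬ V)) ,
                   A-∩ (proj₂ (⟦ φ ⟧ᴬ V)) (proj₂ (⟦ ψ ⟧ᴬ V))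
  ⟦ φ ∨ᶠ ψ ⟧ᴬ V = (proj₁ (⟦ φ ⟧ᴬ V) ⊔ proj₁ (⟦ ψ ⟧ᴬ V)) ,
                   A-⊔ (proj₂ (⟦ φ ⟧ᴬ V)) (proj₂ (⟦ ψ ⟧ᴬ V))
  ⟦ φ ⇒ᶠ ψ ⟧ᴬ V = (⟦ φ ⟧ᴬ V ⇒ₛ proj₁ (⟦ ψ ⟧ᴬ V)) ,
                   A-⇒ (proj₂ (⟦ φ ⟧ᴬ V)) (proj₂ (⟦ ψ ⟧ᴬ V))

  _,_⊩_ : Valuation → X → Formula → Set
  V , x ⊩ φ = proj₁ (⟦ φ ⟧ᴬ V) x

  Validates : Formula → Formula → Set₁
  Validates φ ψ = ∀ (V : Valuation) x → V , x ⊩ φ → V , x ⊩ ψ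

Full : {X : Set} → GSLFrame X → Set₁
Full G = ∀ a → (A a ⇔ IsFilter a)
  where open GSLFrame G

record Topology (X : Set) : Set₁ where
  field
    Open     : Subset X → Set
    Open-ext : ∀ {a b} → a ≐ b → Open a → Open b
    Open-X   : Open (λ _ → ⊤)
    Open-⋃   : (I : Set) (U : I → Subset X) → (∀ i → Open (U i)) →
               Open (λ x → ∃[ i ] U i x)
    Open-∩   : ∀ {a b} → Open a → Open b → Open (a ∩ b)

  Closed : Subset X → Set
  Closed a = Open (λ x → ¬ a x)

  Clopen : Subset X → Set
  Clopen a = Open a × Closed a

  Compact : Set₁
  Compact = (I : Set) (U : I → Subset X) → (∀ i → Open (U i)) →
            (∀ x → ∃[ i ] U i x) →
            ∃[ is ] (∀ x → ∃[ i ] (i ∈ is × U i x))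

record DescriptiveStructure {X : Set} (G : GSLFrame X) : Set₁ where
  open GSLFrame G
  field
    τ        : Topology X
  open Topology τ
  ClopenFilter : Subset X → Set
  ClopenFilter a = IsFilter a × Clopen a
  field
    compact  : Compact
    A≡clopen-filters : ∀ a → (A a ⇔ ClopenFilter a)
    ⊔-clopen : ∀ {a b} → ClopenFilter a → ClopenFilter b → ClopenFilter (a ⊔ b)
    HMS      : ∀ {x y} → ¬ (x ≼ y) → ∃[ a ] (ClopenFilter a × a x × ¬ a y)
    s-closed : ∀ x (a : A-elt) → Closed (s x a) × IsFilter (s x a)
    ⇒-clopen : ∀ (a b : A-elt) → Clopen (a ⇒ₛ proj₁ b)

Descriptive : {X : Set} → GSLFrame X → Set₁
Descriptive G = DescriptiveStructure G

-- Each frame condition is read off the axiom by choosing the valuation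
-- that sends p and q to the given elements of A.  For the reformulations,
-- ↑x ⊆ a whenever x ∈ a (elements of A are filters), and conversely in a
-- full or descriptive frame ↑x is the intersection of the elements of A
-- containing x: in a full frame ↑x itself belongs to A, in a descriptive
-- frame the HMS separation axiom excludes every point outside ↑x (which,
-- constructively, needs excluded middle on x ≼ z).
module Submission where

open import Defs
open import Level using (0ℓ)
open import Data.Nat using (zero; suc)
open import Data.Product using (_×_; proj₁; proj₂; _,_)
open import Data.Sum using (_⊎_; inj₁; inj₂)
open import Data.Empty using (⊥-elim)
open import Function.Bundles using (_⇔_; mk⇔; Equivalence)
open import Axiom.ExcludedMiddle using (ExcludedMiddle)
open import Relation.Nullary using (yes; no)
open import Relation.Binary.PropositionalEquality using (cong; sym; trans)
open import Algebra.Structures using (IsIdempotentCommutativeMonoid)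

module FrameLemmas {X : Set} (G : GSLFrame X) where
  open GSLFrame G
  open Semantics G
  open IsIdempotentCommutativeMonoid isBoundedSemilattice
    using (assoc; identityʳ; idem)

  valuation₁ : A-elt → Valuation
  valuation₁ a _ = a

  valuation₂ : A-elt → A-elt → Valuation
  valuation₂ a b zero    = a
  valuation₂ a b (suc _) = b

  ≼-refl : ∀ x → x ≼ x
  ≼-refl = idem

  ≼-trans : ∀ {x y z} → x ≼ y → y ≼ z → x ≼ z
  ≼-trans {x} {y} {z} x≼y y≼z =
    trans (cong (_⋏ z) (sym x≼y)) (trans (assoc x y z) (trans (cong (x ⋏_) y≼z) x≼y))

  ↑-isFilter : ∀ x → IsFilter (↑ x)
  ↑-isFilter x = record
    { upward = ≼-trans
    ; has-𝟏  = identityʳ x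
    ; meet   = λ {y} {z} x≼y x≼z → trans (sym (assoc x y z)) (trans (cong (_⋏ z) x≼y) x≼z)
    }

  ↑⊆A-elt : ∀ (a : A-elt) {x} → proj₁ a x → ↑ x ⊆ proj₁ a
  ↑⊆A-elt a ax = IsFilter.upward (A⊆𝓕 (proj₂ a)) ax

  A-separates-≼ : ExcludedMiddle 0ℓ → (Full G ⊎ Descriptive G) →
    ∀ {x z} → (∀ (c : A-elt) → proj₁ c x → proj₁ c z) → x ≼ z
  A-separates-≼ _ (inj₁ full) {x} sep =
    sep (↑ x , Equivalence.from (full (↑ x)) (↑-isFilter x)) (≼-refl x)
  A-separates-≼ em (inj₂ d) {x} {z} sep with em {x ≼ z}
  ... | yes x≼z = x≼z
  ... | no  x⋠z =
    let (c , c-clopenFilter , cx , ¬cz) = DescriptiveStructure.HMS d x⋠z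
        c∈A = Equivalence.from (DescriptiveStructure.A≡clopen-filters d c) c-clopenFilter
    in ⊥-elim (¬cz (sep (c , c∈A) cx))

  module _ (em : ExcludedMiddle 0ℓ) (fullOrDescriptive : Full G ⊎ Descriptive G) where

    s-persistent⇔s⊆↑ :
      (∀ x (a b : A-elt) → proj₁ a x → s x b ⊆ proj₁ a)
        ⇔ (∀ x (a : A-elt) → s x a ⊆ ↑ x)
    s-persistent⇔s⊆↑ = mk⇔ to from
      where
      to : (∀ x (a b : A-elt) → proj₁ a x → s x b ⊆ proj₁ a) → ∀ x a → s x a ⊆ ↑ x
      to h x a sxaz = A-separates-≼ em fullOrDescriptive (λ c cx → h x c a cx sxaz)

      from : (∀ x (a : A-elt) → s x a ⊆ ↑ x) →
             ∀ x (a b : A-elt) → proj₁ a x → s x b ⊆ proj₁ a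
      from h x a b ax sxbz = ↑⊆A-elt a ax (h x b sxbz)

    s-persistent-on-self⇔s⊆↑ :
      (∀ x (a b : A-elt) → (proj₁ a ∩ proj₁ b) x → s x a ⊆ proj₁ b)
        ⇔ (∀ x (a : A-elt) → proj₁ a x → s x a ⊆ ↑ x)
    s-persistent-on-self⇔s⊆↑ = mk⇔ to from
      where
      to : (∀ x (a b : A-elt) → (proj₁ a ∩ proj₁ b) x → s x a ⊆ proj₁ b) →
           ∀ x (a : A-elt) → proj₁ a x → s x a ⊆ ↑ x
      to h x a ax sxaz = A-separates-≼ em fullOrDescriptive (λ c cx → h x a c (ax , cx) sxaz)

      from : (∀ x (a : A-elt) → proj₁ a x → s x a ⊆ ↑ x) →
             ∀ x (a b : A-elt) → (proj₁ a ∩ proj₁ b) x → s x a ⊆ proj₁ b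
      from h x a b (ax , bx) sxaz = ↑⊆A-elt b bx (h x a ax sxaz)

proposition5p1 : {X : Set} (G : GSLFrame X) →
    let open GSLFrame G
        open Semantics G
        p = var 0
        q = var 1
    in (Validates ⊤ᶠ (p ⇒ᶠ p) ⇔ (∀ x (a : A-elt) → s x a ⊆ proj₁ a))
     × (Validates p (⊤ᶠ ⇒ᶠ p) ⇔ (∀ x (a : A-elt) → proj₁ a x → s x Xᴬ ⊆ proj₁ a))
     × (Validates p (q ⇒ᶠ p) ⇔ (∀ x (a b : A-elt) → proj₁ a x → s x b ⊆ proj₁ a))
     × (Validates (p ∧ᶠ q) (p ⇒ᶠ q) ⇔
          (∀ x (a b : A-elt) → (proj₁ a ∩ proj₁ b) x → s x a ⊆ proj₁ b))
     × (ExcludedMiddle 0ℓ → (Full G ⊎ Descriptive G) →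
          ((∀ x (a b : A-elt) → proj₁ a x → s x b ⊆ proj₁ a)
             ⇔ (∀ x (a : A-elt) → s x a ⊆ ↑ x))
        × ((∀ x (a b : A-elt) → (proj₁ a ∩ proj₁ b) x → s x a ⊆ proj₁ b)
             ⇔ (∀ x (a : A-elt) → proj₁ a x → s x a ⊆ ↑ x)))
proposition5p1 G =
    mk⇔ (λ v x a → v (valuation₁ a) x _) (λ h V x _ → h x (V 0))
  , mk⇔ (λ v x a → v (valuation₁ a) x) (λ h V x → h x (V 0))
  , mk⇔ (λ v x a b → v (valuation₂ a b) x) (λ h V x → h x (V 0) (V 1))
  , mk⇔ (λ v x a b → v (valuation₂ a b) x) (λ h V x → h x (V 0) (V 1))
  , λ em fullOrDescriptive →
        s-persistent⇔s⊆↑ em fullOrDescriptive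
      , s-persistent-on-self⇔s⊆↑ em fullOrDescriptive
  where
    open GSLFrame G
    open FrameLemmas G
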